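{- Let $p=(\pi^p,a^p)$ be a condition of the forcing $\mathbb P$ such that the range of $a^p$ is contained in $\{S,I\}\times(\omega\restriction|\pi^p|+1)$. Then there is a condition $q\in\mathbb P$ parallel to $p$ (i.e. $\pi^q=\pi^p$) such that for all $x<|\pi^p|$: if $a^p(x)=(S,t)$ for some $t$ then $a^q(x)=(I,|\pi^p|)$, and if $a^p(x)=(I,t)$ for some $t$ then $a^q(x)=(L,|\pi^p|)$.
   Context: $\mathrm{FinPO}$ is the set of partial orders on finite initial segments of $\omega$; for $\pi\in\mathrm{FinPO}$, $|\pi|$ is the $n$ such that $\pi$ orders $\{0,\dots,n-1\}=\omega\restriction n$, and $\le_\pi$ its ordering; $x\mid_\pi y$ means $x,y$ are $\le_\pi$-incomparable. A condition of $\mathbb P$ is a pair $p=(\pi^p,a^p)$ with $\pi^p\in\mathrm{FinPO}$ and $a^p:|\pi^p|\to\{S,L,I\}\times(\omega\restriction|\pi^p|+1)$ such that: either all values of $a^p$ have first coordinate in $\{S,I\}$ or all have first coordinate in $\{L,I\}$; if $a^p(x)=(S,t)$ and $y\le_{\pi^p}x$ then $y<t$ and $a^p(y)=(S,u)$ for some $u$; if $a^p(x)=(L,t)$ and $x\le_{\pi^p}y$ then $y<t$ and $a^p(y)=(L,u)$ for some $u$; if $a^p(x)\in\{(S,t),(L,t)\}$ and $x\mid_{\pi^p}y$ then $y<t$; if $a^p(x)=(I,t)$ and $y$ is $\le_{\pi^p}$-comparable with $x$ then $y<t$. Two conditions $p,q$ are parallel if $\pi^p=\pi^q$. -}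

module Defs where

open import Data.Nat using (ℕ; suc; _<_)
open import Data.Fin using (Fin; toℕ; fromℕ)
open import Data.Product using (_×_; _,_; ∃; proj₁)
open import Data.Sum using (_⊎_)
open import Relation.Nullary using (¬_)
open import Relation.Binary.PropositionalEquality using (_≡_; _≢_)
open import Relation.Binary.Structures using (IsPartialOrder)

-- A partial order on the finite initial segment ω↾n = {0,…,n-1}, represented as Fin n.
record FinPO : Set₁ where
  field
    size  : ℕ
    _≤π_  : Fin size → Fin size → Set
    isPO  : IsPartialOrder _≡_ _≤π_

open FinPO public

data Label : Set where
  S L I : Label

Incomp : (π : FinPO) → Fin (size π) → Fin (size π) → Set
Incomp π x y = ¬ (_≤π_ π x y) × ¬ (_≤π_ π y x)

Comparable : (π : FinPO) → Fin (size π) → Fin (size π) → Set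
Comparable π x y = _≤π_ π x y ⊎ _≤π_ π y x

-- a : |π| → {S,L,I} × (ω↾(|π|+1)); second coordinate in Fin (suc |π|) = {0,…,|π|}
Assignment : FinPO → Set
Assignment π = Fin (size π) → Label × Fin (suc (size π))

record IsCondition (π : FinPO) (a : Assignment π) : Set where
  field
    homog  : (∀ x → proj₁ (a x) ≢ L) ⊎ (∀ x → proj₁ (a x) ≢ S)
    S-down : ∀ x y t → a x ≡ (S , t) → _≤π_ π y x →
               toℕ y < toℕ t × ∃ λ u → a y ≡ (S , u)
    L-up   : ∀ x y t → a x ≡ (L , t) → _≤π_ π x y →
               toℕ y < toℕ t × ∃ λ u → a y ≡ (L , u)
    S-inc  : ∀ x y t → a x ≡ (S , t) → Incomp π x y → toℕ y < toℕ t
    L-inc  : ∀ x y t → a x ≡ (L , t) → Incomp π x y → toℕ y < toℕ t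
    I-comp : ∀ x y t → a x ≡ (I , t) → Comparable π x y → toℕ y < toℕ t

record Condition : Set₁ where
  field
    π   : FinPO
    a   : Assignment π
    isC : IsCondition π a

open Condition public

-- Move every point one step up the chain S < I < L and raise every bound to the top value |π|.
-- All bounds then hold trivially, no point carries S, and L is upward closed because the
-- S-points of p were downward closed: if x ≤ y and y were an S-point, so would be x.
module Submission where

open import Defs
open import Data.Nat using (suc; _<_)
open import Data.Fin using (Fin; fromℕ; toℕ)
open import Data.Fin.Properties using (toℕ<n; toℕ-fromℕ)
open import Data.Product using (Σ; _×_; _,_; proj₁; proj₂; ∃)
open import Data.Sum using (_⊎_; inj₁; inj₂)
open import Relation.Nullary using (contradiction)
open import Relation.Binary.PropositionalEquality using (_≡_; _≢_; refl; sym; cong; subst)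

shift : Label → Label
shift S = I
shift _ = L

shift-≢S : ∀ l → shift l ≢ S
shift-≢S S ()
shift-≢S L ()
shift-≢S I ()

shift≡L⇒≢S : ∀ {l} → shift l ≡ L → l ≢ S
shift≡L⇒≢S () refl

≡S⊎shift≡L : ∀ l → l ≡ S ⊎ shift l ≡ L
≡S⊎shift≡L S = inj₁ refl
≡S⊎shift≡L L = inj₂ refl
≡S⊎shift≡L I = inj₂ refl

promote-value : ∀ n → Label × Fin (suc n) → Label × Fin (suc n)
promote-value n (l , _) = shift l , fromℕ n

promote : ∀ π → Assignment π → Assignment π
promote π a x = promote-value (size π) (a x)

module _ {π : FinPO} {a : Assignment π} where

  private
    n = size π

  promote-bound : ∀ x y {k t} → promote π a x ≡ (k , t) → toℕ y < toℕ t
  promote-bound x y e =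
    subst (λ t → toℕ y < toℕ t) (cong proj₂ e)
          (subst (toℕ y <_) (sym (toℕ-fromℕ n)) (toℕ<n y))

  promote-≢S : ∀ x {t} → promote π a x ≢ (S , t)
  promote-≢S x e = shift-≢S (proj₁ (a x)) (cong proj₁ e)

  promote-L-up : IsCondition π a → ∀ x y {t} → promote π a x ≡ (L , t) → _≤π_ π x y →
                 ∃ λ u → promote π a y ≡ (L , u)
  promote-L-up isC x y e x≤y with ≡S⊎shift≡L (proj₁ (a y))
  ... | inj₂ e′ = fromℕ n , cong (_, fromℕ n) e′
  ... | inj₁ yS =
    let (_ , _ , ax≡S) = IsCondition.S-down isC y x (proj₂ (a y)) (cong (_, proj₂ (a y)) yS) x≤y
    in  contradiction (cong proj₁ ax≡S) (shift≡L⇒≢S (cong proj₁ e))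

  promote-isCondition : IsCondition π a → IsCondition π (promote π a)
  promote-isCondition isC = record
    { homog  = inj₂ λ x → shift-≢S (proj₁ (a x))
    ; S-down = λ x _ _ e _ → contradiction e (promote-≢S x)
    ; L-up   = λ x y _ e x≤y → promote-bound x y e , promote-L-up isC x y e x≤y
    ; S-inc  = λ x _ _ e _ → contradiction e (promote-≢S x)
    ; L-inc  = λ x y _ e _ → promote-bound x y e
    ; I-comp = λ x y _ e _ → promote-bound x y e
    }

lemma1 : (p : Condition) →
    (∀ x → proj₁ (a p x) ≡ S ⊎ proj₁ (a p x) ≡ I) →
    Σ (Assignment (π p)) λ aq → IsCondition (π p) aq ×
      (∀ (x : Fin (size (π p))) →
        ((∃ λ t → a p x ≡ (S , t)) → aq x ≡ (I , fromℕ (size (π p)))) ×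
        ((∃ λ t → a p x ≡ (I , t)) → aq x ≡ (L , fromℕ (size (π p)))))
lemma1 p _ = promote (π p) (a p) , promote-isCondition (isC p) , λ _ →
    (λ (_ , e) → cong (promote-value _) e) , (λ (_ , e) → cong (promote-value _) e)
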